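{- For every integer $n\ge 1$, with $a,b$ the two colors of $C_2$, $$\left|\Pi_n^{eq}\wr C_2(\{1^a2^a,1^b2^b\})\right|=2(2^n-1)=2^{n+1}-2.$$
   Context: $\Pi_n\wr C_2$ is the set of colored set partitions of $[n]$ with colors $a,b$ (a set partition of $[n]$ plus a color for each element). A colored partition eq-contains $1^\gamma2^\gamma$ if there are elements $x<y$ in different blocks both colored $\gamma$. $\Pi_n^{eq}\wr C_2(\{1^a2^a,1^b2^b\})$ is the set of colored partitions eq-containing neither $1^a2^a$ nor $1^b2^b$. -}

module Defs where

open import Data.Nat using (ℕ; zero; suc; _≤_; _⊔_)
open import Data.Fin using (Fin) renaming (_<_ to _<ᶠ_)
open import Data.Vec using (Vec; []; _∷_; lookup)
open import Data.Product using (_×_; _,_; ∃; ∃-syntax)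
open import Data.Unit using (⊤)
open import Relation.Binary.PropositionalEquality using (_≡_; _≢_)
open import Relation.Nullary using (¬_)

data Color : Set where
  a b : Color

-- A set partition of [n] is encoded canonically by its restricted growth
-- function: v i = index of the block containing i (blocks numbered in order of
-- their minimal elements).  RGFFrom m v : every entry is at most the number m
-- of blocks opened so far (i.e. it joins an old block or opens block m).
RGFFrom : {k : ℕ} → ℕ → Vec ℕ k → Set
RGFFrom m [] = ⊤
RGFFrom m (x ∷ xs) = (x ≤ m) × RGFFrom (m ⊔ suc x) xs

IsRGF : {n : ℕ} → Vec ℕ n → Set
IsRGF = RGFFrom 0

ColPart : ℕ → Set
ColPart n = Vec ℕ n × Vec Color n

IsColPart : {n : ℕ} → ColPart n → Set
IsColPart (v , c) = IsRGF v

EqContains11 : {n : ℕ} → Color → ColPart n → Set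
EqContains11 {n} γ (v , c) =
  ∃[ x ] ∃[ y ] (x <ᶠ y) × (lookup v x ≢ lookup v y) × (lookup c x ≡ γ) × (lookup c y ≡ γ)

InAvoidClass : {n : ℕ} → ColPart n → Set
InAvoidClass p = IsColPart p × ¬ EqContains11 a p × ¬ EqContains11 b p

module Submission where

-- A coloured partition avoids 1^γ2^γ exactly when all γ-coloured elements lie
-- in one block.  Scanning [n+1] from the left, the first element (colour c₀)
-- opens block 0; as long as only c₀ occurs, every element must join block 0.
-- The first element of the other colour either joins block 0 as well (then
-- the whole partition is a single block) or opens block 1 (then block 0 is
-- exactly the c₀-coloured elements and block 1 the others).  In both cases
-- the rest of the partition is determined by its colouring, a "labelled"
-- partition, and there are 2^m colourings of the m remaining elements.

open import Defs
open import Data.Nat using (ℕ; zero; suc; _+_; _*_; _^_; _∸_; _≤_; z≤n; s≤s; _≟_)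
open import Data.Nat.Properties using (≤-refl; ≤-trans; m≤m⊔n; +-identityʳ; +-assoc; +-comm; m+n∸n≡m)
open import Data.Fin using () renaming (zero to fzero; suc to fsuc)
open import Data.Vec using (Vec; []; _∷_; lookup; head) renaming (map to vmap)
open import Data.Vec.Properties using (lookup-map; ∷-injectiveʳ)
open import Data.Vec.Relation.Binary.Pointwise.Extensional using (ext; Pointwise-≡⇒≡)
open import Data.List using (List; []; _∷_; map; _++_; length)
open import Data.List.Properties using (length-map; length-++)
open import Data.List.Membership.Propositional using (_∈_)
open import Data.List.Membership.Propositional.Properties using (∈-map⁺; ∈-map⁻; ∈-++⁺ˡ; ∈-++⁺ʳ; ∈-++⁻)
open import Data.List.Relation.Unary.Any using (here)
open import Data.List.Relation.Unary.All using (All)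
import Data.List.Relation.Unary.All as All
import Data.List.Relation.Unary.All.Properties as All
open import Data.List.Relation.Unary.Unique.Propositional using (Unique)
import Data.List.Relation.Unary.Unique.Propositional.Properties as Unique
import Data.List.Relation.Unary.AllPairs as AllPairs
open import Data.List.Relation.Binary.Disjoint.Propositional using (Disjoint)
open import Data.Product using (_×_; _,_; proj₁; proj₂; ∃-syntax)
open import Data.Sum using (_⊎_; inj₁; inj₂)
open import Data.Unit using (tt)
open import Function.Bundles using (_⇔_; mk⇔)
open import Relation.Nullary using (¬_)
open import Relation.Nullary.Decidable using (decidable-stable)
open import Relation.Binary.PropositionalEquality using (_≡_; _≢_; refl; sym; trans; cong; cong₂; subst; module ≡-Reasoning)

private variable
  n : ℕ
  y m : ℕ
  k : Color → ℕ
  γ c₀ d : Color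
  v : Vec ℕ n
  c : Vec Color n

other : Color → Color
other a = b
other b = a

other-≢ : ∀ c₀ → other c₀ ≢ c₀
other-≢ a ()
other-≢ b ()

colour-cases : ∀ c₀ γ → γ ≡ c₀ ⊎ γ ≡ other c₀
colour-cases a a = inj₁ refl
colour-cases a b = inj₂ refl
colour-cases b a = inj₂ refl
colour-cases b b = inj₁ refl

-- The block assignment putting colour c₀ into block 0 and the other colour
-- into block y: y = 0 is the one-block partition, y = 1 the two-block one.
blocks : Color → ℕ → Color → ℕ
blocks a y a = 0
blocks a y b = y
blocks b y a = y
blocks b y b = 0

blocks-self : ∀ c₀ y → blocks c₀ y c₀ ≡ 0
blocks-self a y = refl
blocks-self b y = refl

blocks-other : ∀ c₀ y → blocks c₀ y (other c₀) ≡ y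
blocks-other a y = refl
blocks-other b y = refl

blocks-≤ : ∀ c₀ y γ → blocks c₀ y γ ≤ y
blocks-≤ a y a = z≤n
blocks-≤ a y b = ≤-refl
blocks-≤ b y a = ≤-refl
blocks-≤ b y b = z≤n

-- A label word all of whose entries are at most m is a restricted growth word
-- from m, since the admissible bound only grows along the word.
bounded-rgf : (v : Vec ℕ n) → (∀ j → lookup v j ≤ m) → RGFFrom m v
bounded-rgf [] bound = tt
bounded-rgf (x ∷ v) bound = bound fzero , bounded-rgf v (λ j → ≤-trans (bound (fsuc j)) (m≤m⊔n _ _))

-- They are records so that the partition stays inferable from their types.

record Avoids (γ : Color) (p : ColPart n) : Set where
  constructor mkAvoids
  field avoids : ¬ EqContains11 γ p

record InBlock (γ : Color) (k : ℕ) (p : ColPart n) : Set where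
  constructor mkInBlock
  field inBlock : ∀ j → lookup (proj₂ p) j ≡ γ → lookup (proj₁ p) j ≡ k

avoids-empty : Avoids γ ([] , [])
avoids-empty = mkAvoids λ { (() , _) }

avoids-tail : Avoids γ (y ∷ v , d ∷ c) → Avoids γ (v , c)
avoids-tail (mkAvoids avoid) =
  mkAvoids λ { (i , j , i<j , ≢ , ci , cj) → avoid (fsuc i , fsuc j , s≤s i<j , ≢ , ci , cj) }

inBlock-tail : InBlock γ m (y ∷ v , d ∷ c) → InBlock γ m (v , c)
inBlock-tail (mkInBlock inBlock) = mkInBlock λ j → inBlock (fsuc j)

avoids-head : Avoids γ (y ∷ v , γ ∷ c) → InBlock γ y (v , c)
avoids-head (mkAvoids avoid) = mkInBlock λ j cj →
  decidable-stable (_ ≟ _) (λ ≢ → avoid (fzero , fsuc j , s≤s z≤n , (λ e → ≢ (sym e)) , refl , cj))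

avoids-cons : Avoids γ (v , c) → (d ≡ γ → InBlock γ y (v , c)) → Avoids γ (y ∷ v , d ∷ c)
avoids-cons (mkAvoids avoid) sameBlock = mkAvoids λ where
  (fzero , fsuc j , _ , ≢ , dγ , cj) → ≢ (sym (InBlock.inBlock (sameBlock dγ) j cj))
  (fsuc i , fsuc j , s≤s i<j , ≢ , ci , cj) → avoid (i , j , i<j , ≢ , ci , cj)
  (fzero , fzero , () , _)
  (fsuc i , fzero , () , _)

both-avoid : {p : ColPart n} → ¬ EqContains11 a p → ¬ EqContains11 b p → ∀ γ → Avoids γ p
both-avoid avoid-a avoid-b a = mkAvoids avoid-a
both-avoid avoid-a avoid-b b = mkAvoids avoid-b

record Labelled (k : Color → ℕ) (p : ColPart n) : Set where
  constructor mkLabelled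
  field labels : ∀ j → lookup (proj₁ p) j ≡ k (lookup (proj₂ p) j)

labelled-cons : k d ≡ y → Labelled k (v , c) → Labelled k (y ∷ v , d ∷ c)
labelled-cons head-label (mkLabelled labels) =
  mkLabelled λ { fzero → sym head-label ; (fsuc j) → labels j }

labelled-inBlock : Labelled k (v , c) → ∀ γ → InBlock γ (k γ) (v , c)
labelled-inBlock {k = k} (mkLabelled labels) γ = mkInBlock λ j cj → trans (labels j) (cong k cj)

labelled-avoids : Labelled k (v , c) → Avoids γ (v , c)
labelled-avoids {k = k} (mkLabelled labels) = mkAvoids λ { (i , j , _ , ≢ , ci , cj) →
  ≢ (trans (labels i) (trans (cong k (trans ci (sym cj))) (sym (labels j)))) }

labelled-blocks : ∀ c₀ y → InBlock c₀ 0 (v , c) → InBlock (other c₀) y (v , c) →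
                  Labelled (blocks c₀ y) (v , c)
labelled-blocks {c = c} c₀ y (mkInBlock inBlock₀) (mkInBlock inBlockʸ) = mkLabelled labels
  where
  labels : ∀ j → _
  labels j with colour-cases c₀ (lookup c j)
  ... | inj₁ e = trans (inBlock₀ j e) (sym (trans (cong (blocks c₀ y) e) (blocks-self c₀ y)))
  ... | inj₂ e = trans (inBlockʸ j e) (sym (trans (cong (blocks c₀ y) e) (blocks-other c₀ y)))

colourings : (n : ℕ) → List (Vec Color n)
colourings zero = [] ∷ []
colourings (suc n) = map (a ∷_) (colourings n) ++ map (b ∷_) (colourings n)

colourings-complete : (c : Vec Color n) → c ∈ colourings n
colourings-complete [] = here refl
colourings-complete (a ∷ c) = ∈-++⁺ˡ (∈-map⁺ (a ∷_) (colourings-complete c))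
colourings-complete {suc n} (b ∷ c) =
  ∈-++⁺ʳ (map (a ∷_) (colourings n)) (∈-map⁺ (b ∷_) (colourings-complete c))

map-disjoint : {A B : Set} {f g : A → B} {xs ys : List A} →
               (∀ x y → f x ≢ g y) → Disjoint (map f xs) (map g ys)
map-disjoint {f = f} {g} f≢g (in-f , in-g) with ∈-map⁻ f in-f | ∈-map⁻ g in-g
... | x , _ , refl | y , _ , e = f≢g x y e

disjoint-++ʳ : {A : Set} {xs ys zs : List A} → Disjoint xs ys → Disjoint xs zs → Disjoint xs (ys ++ zs)
disjoint-++ʳ {ys = ys} disjoint-ys disjoint-zs (in-xs , in-++) with ∈-++⁻ ys in-++
... | inj₁ in-ys = disjoint-ys (in-xs , in-ys)
... | inj₂ in-zs = disjoint-zs (in-xs , in-zs)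

unique-singleton : {A : Set} (x : A) → Unique (x ∷ [])
unique-singleton x = All.[] AllPairs.∷ AllPairs.[]

colourings-unique : ∀ n → Unique (colourings n)
colourings-unique zero = unique-singleton []
colourings-unique (suc n) =
  Unique.++⁺ (Unique.map⁺ ∷-injectiveʳ (colourings-unique n)) (Unique.map⁺ ∷-injectiveʳ (colourings-unique n))
             (map-disjoint (λ _ _ ()))

double : ∀ x → x + x ≡ 2 * x
double x = cong (x +_) (sym (+-identityʳ x))

colourings-length : ∀ n → length (colourings n) ≡ 2 ^ n
colourings-length zero = refl
colourings-length (suc n) = begin
  length (map (a ∷_) (colourings n) ++ map (b ∷_) (colourings n))
    ≡⟨ length-++ (map (a ∷_) (colourings n)) ⟩
  length (map (a ∷_) (colourings n)) + length (map (b ∷_) (colourings n))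
    ≡⟨ cong₂ _+_ (length-map (a ∷_) (colourings n)) (length-map (b ∷_) (colourings n)) ⟩
  length (colourings n) + length (colourings n)
    ≡⟨ cong₂ _+_ (colourings-length n) (colourings-length n) ⟩
  2 ^ n + 2 ^ n
    ≡⟨ double (2 ^ n) ⟩
  2 ^ suc n ∎
  where open ≡-Reasoning

labelledBy : (Color → ℕ) → Vec Color n → ColPart n
labelledBy k c = vmap k c , c

labelledList : (Color → ℕ) → (n : ℕ) → List (ColPart n)
labelledList k n = map (labelledBy k) (colourings n)

labelledList-sound : ∀ k n → All (Labelled k) (labelledList k n)
labelledList-sound k n = All.map⁺ (All.universal (λ c → mkLabelled λ j → lookup-map j k c) (colourings n))

labelledList-complete : Labelled k (v , c) → (v , c) ∈ labelledList k n
labelledList-complete {k = k} {v = v} {c = c} (mkLabelled labels) =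
  subst (λ w → (w , c) ∈ labelledList k _) (sym v≡map)
        (∈-map⁺ (labelledBy k) (colourings-complete c))
  where
  v≡map : v ≡ vmap k c
  v≡map = Pointwise-≡⇒≡ (ext λ j → trans (labels j) (sym (lookup-map j k c)))

labelledList-unique : ∀ k n → Unique (labelledList k n)
labelledList-unique k n = Unique.map⁺ (cong proj₂) (colourings-unique n)

labelledList-length : ∀ k n → length (labelledList k n) ≡ 2 ^ n
labelledList-length k n = trans (length-map (labelledBy k) (colourings n)) (colourings-length n)

addFirst : ℕ → Color → ColPart n → ColPart (suc n)
addFirst y d (v , c) = y ∷ v , d ∷ c

prefix : ℕ → Color → List (ColPart n) → List (ColPart (suc n))
prefix y d = map (addFirst y d)

prefix-unique : {xs : List (ColPart n)} → Unique xs → Unique (prefix y d xs)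
prefix-unique = Unique.map⁺ addFirst-injective
  where
  addFirst-injective : {p q : ColPart n} → addFirst y d p ≡ addFirst y d q → p ≡ q
  addFirst-injective {p = _ , _} {q = _ , _} refl = refl

prefix-disjoint : ∀ {y′ d′} {xs ys : List (ColPart n)} →
                  (y , d) ≢ (y′ , d′) → Disjoint (prefix y d xs) (prefix y′ d′ ys)
prefix-disjoint heads≢ = map-disjoint λ p q e → heads≢ (cong firstElement e)
  where
  firstElement : ColPart (suc n) → ℕ × Color
  firstElement (v , c) = head v , head c

prefix-length : (xs : List (ColPart n)) → length (prefix y d xs) ≡ length xs
prefix-length {y = y} {d = d} = length-map (addFirst y d)

-- Tail c₀ p: p may follow a first element of colour c₀ in block 0, i.e. the
-- partition addFirst 0 c₀ p belongs to the class (see class-head/class-cons).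
-- This is also the state after any run of c₀-coloured elements in block 0.

record Tail (c₀ : Color) (p : ColPart n) : Set where
  constructor mkTail
  field
    rgf : RGFFrom 1 (proj₁ p)
    avoidsAll : ∀ γ → Avoids γ p
    firstBlock : InBlock c₀ 0 p

class-head : InAvoidClass (y ∷ v , d ∷ c) → y ≡ 0 × Tail d (v , c)
class-head {d = d} ((z≤n , rgf) , avoid-a , avoid-b) =
  refl , mkTail rgf (λ γ → avoids-tail (avoid γ)) (avoids-head (avoid d))
  where avoid = both-avoid avoid-a avoid-b

class-cons : Tail d (v , c) → InAvoidClass (0 ∷ v , d ∷ c)
class-cons {d = d} {v = v} {c = c} (mkTail rgf avoid sameBlock) =
  (z≤n , rgf) , Avoids.avoids (extend a) , Avoids.avoids (extend b)
  where
  extend : ∀ γ → Avoids γ (0 ∷ v , d ∷ c)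
  extend γ = avoids-cons (avoid γ) λ { refl → sameBlock }

tail-head : Tail c₀ (y ∷ v , d ∷ c) →
            (d ≡ c₀ × y ≡ 0 × Tail c₀ (v , c))
            ⊎ (d ≡ other c₀ × y ≤ 1 × Labelled (blocks c₀ y) (v , c))
tail-head {c₀ = c₀} {y = y} {d = d} (mkTail (y≤1 , rgf) avoid sameBlock) with colour-cases c₀ d
... | inj₁ refl with InBlock.inBlock sameBlock fzero refl
...   | refl = inj₁ (refl , refl , mkTail rgf (λ γ → avoids-tail (avoid γ)) (inBlock-tail sameBlock))
tail-head {c₀ = c₀} {y = y} (mkTail (y≤1 , rgf) avoid sameBlock) | inj₂ refl =
  inj₂ (refl , y≤1 , labelled-blocks c₀ y (inBlock-tail sameBlock) (avoids-head (avoid (other c₀))))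

tail-repeat : Tail c₀ (v , c) → Tail c₀ (0 ∷ v , c₀ ∷ c)
tail-repeat (mkTail rgf avoid (mkInBlock inBlock)) =
  mkTail (z≤n , rgf) (λ γ → avoids-cons (avoid γ) λ { refl → mkInBlock inBlock })
         (mkInBlock λ { fzero _ → refl ; (fsuc j) → inBlock j })

tail-switch : y ≤ 1 → Labelled (blocks c₀ y) (v , c) → Tail c₀ (y ∷ v , other c₀ ∷ c)
tail-switch {y = y} {c₀ = c₀} {v = v} {c = c} y≤1 labelled =
  mkTail (bounded-rgf (y ∷ v) (λ j → subst (_≤ 1) (sym (Labelled.labels labelled′ j))
                                           (≤-trans (blocks-≤ c₀ y _) y≤1)))
         (λ γ → labelled-avoids labelled′)
         (subst (λ k → InBlock c₀ k (y ∷ v , other c₀ ∷ c)) (blocks-self c₀ y) (labelled-inBlock labelled′ c₀))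
  where
  labelled′ : Labelled (blocks c₀ y) (y ∷ v , other c₀ ∷ c)
  labelled′ = labelled-cons (blocks-other c₀ y) labelled

switched : Color → ℕ → (n : ℕ) → List (ColPart (suc n))
switched c₀ y n = prefix y (other c₀) (labelledList (blocks c₀ y) n)

tails : Color → (n : ℕ) → List (ColPart n)
tails c₀ zero = ([] , []) ∷ []
tails c₀ (suc n) = prefix 0 c₀ (tails c₀ n) ++ (switched c₀ 0 n ++ switched c₀ 1 n)

tails-sound : ∀ c₀ n → All (Tail c₀) (tails c₀ n)
tails-sound c₀ zero = mkTail tt (λ γ → avoids-empty) (mkInBlock λ ()) All.∷ All.[]
tails-sound c₀ (suc n) =
  All.++⁺ (All.map⁺ (All.map tail-repeat (tails-sound c₀ n)))
          (All.++⁺ (switched-sound 0 z≤n) (switched-sound 1 ≤-refl))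
  where
  switched-sound : ∀ y → y ≤ 1 → All (Tail c₀) (switched c₀ y n)
  switched-sound y y≤1 = All.map⁺ (All.map (tail-switch y≤1) (labelledList-sound (blocks c₀ y) n))

tails-complete : ∀ c₀ n (p : ColPart n) → Tail c₀ p → p ∈ tails c₀ n
tails-complete c₀ zero ([] , []) _ = here refl
tails-complete c₀ (suc n) (y ∷ v , d ∷ c) tail with tail-head tail
... | inj₁ (refl , refl , tail′) = ∈-++⁺ˡ (∈-map⁺ (addFirst 0 c₀) (tails-complete c₀ n (v , c) tail′))
... | inj₂ (refl , z≤n , labelled) =
  ∈-++⁺ʳ (prefix 0 c₀ (tails c₀ n)) (∈-++⁺ˡ (∈-map⁺ (addFirst 0 (other c₀)) (labelledList-complete labelled)))
... | inj₂ (refl , s≤s z≤n , labelled) =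
  ∈-++⁺ʳ (prefix 0 c₀ (tails c₀ n)) (∈-++⁺ʳ (switched c₀ 0 n)
    (∈-map⁺ (addFirst 1 (other c₀)) (labelledList-complete labelled)))

tails-unique : ∀ c₀ n → Unique (tails c₀ n)
tails-unique c₀ zero = unique-singleton ([] , [])
tails-unique c₀ (suc n) =
  Unique.++⁺ (prefix-unique (tails-unique c₀ n))
             (Unique.++⁺ (switched-unique 0) (switched-unique 1) (prefix-disjoint λ ()))
             (disjoint-++ʳ {ys = switched c₀ 0 n} {zs = switched c₀ 1 n} (prefix-disjoint λ e → other-≢ c₀ (sym (cong proj₂ e))) (prefix-disjoint λ ()))
  where
  switched-unique : ∀ y → Unique (switched c₀ y n)
  switched-unique y = prefix-unique (labelledList-unique (blocks c₀ y) n)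

-- |tails c₀ n| = 2^(n+1) − 1, stated without truncated subtraction.
tails-length : ∀ c₀ n → length (tails c₀ n) + 1 ≡ 2 ^ suc n
tails-length c₀ zero = refl
tails-length c₀ (suc n) = begin
  length (tails c₀ (suc n)) + 1
    ≡⟨ cong (_+ 1) step ⟩
  L + (s + s) + 1
    ≡⟨ +-assoc L (s + s) 1 ⟩
  L + ((s + s) + 1)
    ≡⟨ cong (L +_) (+-comm (s + s) 1) ⟩
  L + (1 + (s + s))
    ≡⟨ sym (+-assoc L 1 (s + s)) ⟩
  (L + 1) + (s + s)
    ≡⟨ cong₂ _+_ (tails-length c₀ n) (double s) ⟩
  2 ^ suc n + 2 ^ suc n
    ≡⟨ double (2 ^ suc n) ⟩
  2 ^ suc (suc n) ∎
  where
  open ≡-Reasoning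
  L = length (tails c₀ n)
  s = 2 ^ n
  switched-length : ∀ y → length (switched c₀ y n) ≡ s
  switched-length y = trans (prefix-length (labelledList (blocks c₀ y) n)) (labelledList-length (blocks c₀ y) n)
  step : length (tails c₀ (suc n)) ≡ L + (s + s)
  step = trans (length-++ (prefix 0 c₀ (tails c₀ n)))
           (cong₂ _+_ (prefix-length (tails c₀ n))
                      (trans (length-++ (switched c₀ 0 n)) (cong₂ _+_ (switched-length 0) (switched-length 1))))

classList : (n : ℕ) → List (ColPart (suc n))
classList n = prefix 0 a (tails a n) ++ prefix 0 b (tails b n)

classList-sound : ∀ n → All InAvoidClass (classList n)
classList-sound n = All.++⁺ (started a) (started b)
  where
  started : ∀ c₀ → All InAvoidClass (prefix 0 c₀ (tails c₀ n))
  started c₀ = All.map⁺ (All.map class-cons (tails-sound c₀ n))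

classList-complete : ∀ n (p : ColPart (suc n)) → InAvoidClass p → p ∈ classList n
classList-complete n (_ ∷ v , a ∷ c) member with class-head member
... | refl , tail = ∈-++⁺ˡ (∈-map⁺ (addFirst 0 a) (tails-complete a n (v , c) tail))
classList-complete n (_ ∷ v , b ∷ c) member with class-head member
... | refl , tail = ∈-++⁺ʳ (prefix 0 a (tails a n)) (∈-map⁺ (addFirst 0 b) (tails-complete b n (v , c) tail))

classList-unique : ∀ n → Unique (classList n)
classList-unique n = Unique.++⁺ (prefix-unique (tails-unique a n)) (prefix-unique (tails-unique b n)) (prefix-disjoint λ ())

classList-length : ∀ n → length (classList n) ≡ 2 * (2 ^ suc n ∸ 1)
classList-length n = begin
  length (classList n)
    ≡⟨ length-++ (prefix 0 a (tails a n)) ⟩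
  length (prefix 0 a (tails a n)) + length (prefix 0 b (tails b n))
    ≡⟨ cong₂ _+_ (trans (prefix-length (tails a n)) (tails-length′ a)) (trans (prefix-length (tails b n)) (tails-length′ b)) ⟩
  (2 ^ suc n ∸ 1) + (2 ^ suc n ∸ 1)
    ≡⟨ double (2 ^ suc n ∸ 1) ⟩
  2 * (2 ^ suc n ∸ 1) ∎
  where
  open ≡-Reasoning
  tails-length′ : ∀ c₀ → length (tails c₀ n) ≡ 2 ^ suc n ∸ 1
  tails-length′ c₀ = trans (sym (m+n∸n≡m (length (tails c₀ n)) 1)) (cong (_∸ 1) (tails-length c₀ n))

theorem3p3 : (n : ℕ) → 1 ≤ n →
    ∃[ xs ] (Unique {A = ColPart n} xs × (∀ p → (p ∈ xs) ⇔ InAvoidClass p)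
      × length xs ≡ 2 * (2 ^ n ∸ 1))
theorem3p3 (suc n) _ =
  classList n ,
  classList-unique n ,
  (λ p → mk⇔ (All.lookup (classList-sound n)) (classList-complete n p)) ,
  classList-length n
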